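{- Let $C_n$ be a cycle on $n$ vertices and let $r$ be a positive integer with $r<\lfloor n/2\rfloor$. If $n\equiv i \pmod{r+1}$ (with $0\le i\le r$), then the sparing number of the $r$-th power of $C_n$ is \[\varphi(C_n^r)=\frac{r}{r+1}\bigl((r-1)n+2i\bigr).\]
   Context: All graphs are simple and finite. $\mathbb{N}_0$ denotes the set of non-negative integers. For non-empty $A,B\subseteq\mathbb{N}_0$, $A+B=\{a+b: a\in A, b\in B\}$. An integer additive set-indexer (IASI) of a graph $G$ is an injective function $f:V(G)\to\mathcal{P}(\mathbb{N}_0)$ with non-empty values such that the induced map $f^+(uv)=f(u)+f(v)$ on $E(G)$ is also injective. An IASI is weak if $|f^+(uv)|=\max(|f(u)|,|f(v)|)$ for every edge $uv$. An element (vertex or edge) is mono-indexed if its set-label has cardinality $1$. The sparing number $\varphi(H)$ of a graph $H$ is the minimum number of mono-indexed edges over all weak IASIs of $H$. The $r$-th power $G^r$ of $G$ has vertex set $V(G)$, two distinct vertices adjacent iff their distance in $G$ is at most $r$. -}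

module Defs where

open import Data.Nat using (ℕ; zero; suc; _+_; _*_; _∸_; _≤_; _<_; _⊔_; _%_)
open import Data.Fin using (Fin; toℕ)
open import Data.List using (List; length)
open import Data.List.Membership.Propositional using (_∈_)
open import Data.List.Relation.Unary.Unique.Propositional using (Unique)
open import Data.Product using (Σ; ∃; _×_; _,_)
open import Data.Sum using (_⊎_)
open import Relation.Binary.PropositionalEquality using (_≡_; _≢_)

record Graph : Set₁ where
  field
    order : ℕ
    Adj   : Fin order → Fin order → Set
open Graph public

CycSucc : (n : ℕ) → Fin n → Fin n → Set
CycSucc n i j = (toℕ j ≡ suc (toℕ i)) ⊎ (toℕ j ≡ 0 × suc (toℕ i) ≡ n)

Cycle : ℕ → Graph
Cycle n = record
  { order = n
  ; Adj   = λ i j → CycSucc n i j ⊎ CycSucc n j i }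

data Walk (G : Graph) : Fin (order G) → Fin (order G) → ℕ → Set where
  nil  : ∀ {u} → Walk G u u 0
  cons : ∀ {u w v k} → Adj G u w → Walk G w v k → Walk G u v (suc k)

Power : Graph → ℕ → Graph
Power G r = record
  { order = order G
  ; Adj   = λ u v → u ≢ v × (Σ ℕ λ k → k ≤ r × Walk G u v k) }

SubsetN : Set₁
SubsetN = ℕ → Set

SameSet : SubsetN → SubsetN → Set
SameSet A B = ∀ x → (A x → B x) × (B x → A x)

_⊕_ : SubsetN → SubsetN → SubsetN
(A ⊕ B) x = Σ ℕ λ a → Σ ℕ λ b → A a × B b × x ≡ a + b

HasCard : SubsetN → ℕ → Set
HasCard A k = Σ (List ℕ) λ xs → Unique xs × length xs ≡ k × (∀ x → (A x → x ∈ xs) × (x ∈ xs → A x))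

NonEmpty : SubsetN → Set
NonEmpty A = Σ ℕ A

Finite : SubsetN → Set
Finite A = Σ ℕ (HasCard A)

record IASI (G : Graph) (f : Fin (order G) → SubsetN) : Set where
  field
    nonEmpty  : ∀ v → NonEmpty (f v)
    finite    : ∀ v → Finite (f v)
    injective : ∀ u v → SameSet (f u) (f v) → u ≡ v
    edgeInjective : ∀ u v x y → Adj G u v → Adj G x y →
                    SameSet (f u ⊕ f v) (f x ⊕ f y) →
                    (u ≡ x × v ≡ y) ⊎ (u ≡ y × v ≡ x)

record WeakIASI (G : Graph) (f : Fin (order G) → SubsetN) : Set where
  field
    iasi : IASI G f
    weak : ∀ u v → Adj G u v → ∀ a b → HasCard (f u) a → HasCard (f v) b →
           HasCard (f u ⊕ f v) (a ⊔ b)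

-- Edge uv (taken once, with toℕ u < toℕ v) is mono-indexed under f.
MonoEdge : (G : Graph) → (Fin (order G) → SubsetN) → Fin (order G) → Fin (order G) → Set
MonoEdge G f u v = toℕ u < toℕ v × Adj G u v × HasCard (f u ⊕ f v) 1

MonoCount : (G : Graph) → (Fin (order G) → SubsetN) → ℕ → Set
MonoCount G f m =
  Σ (List (Fin (order G) × Fin (order G))) λ es →
    Unique es × length es ≡ m ×
    (∀ u v → (MonoEdge G f u v → (u , v) ∈ es) × ((u , v) ∈ es → MonoEdge G f u v))

IsSparingNumber : Graph → ℕ → Set₁
IsSparingNumber G φ =
  (Σ (Fin (order G) → SubsetN) λ f → WeakIASI G f × MonoCount G f φ) ×
  (∀ f m → WeakIASI G f → MonoCount G f m → φ ≤ m)

-- Let 2r < n, R = r + 1 and q = ⌊n/R⌋.  We show φ(C_n^r) = r(n − 2q), which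
-- equals r/(r+1)·((r−1)n + 2i) when n ≡ i (mod R).
--
-- * Weakness: if |A|, |B| ≥ 2 then |A + B| > max(|A|,|B|), so in a weak IASI
--   the vertices with non-singleton labels ("heavy") are pairwise non-adjacent.
-- * Rows: since 2r < n, the edges of C_n^r are the rn distinct pairs
--   {v, v + d mod n} (v < n, 1 ≤ d ≤ r).  In row d every vertex lies on two
--   pairs, so with s independent heavy vertices row d has n − 2s edges whose
--   ends are both singletons, hence mono-indexed.
-- * Packing: r + 1 cyclically consecutive vertices contain at most one heavy
--   vertex; averaging over the n windows gives s(r + 1) ≤ n, so s ≤ q and
--   every weak IASI has at least r(n − 2q) mono-indexed edges.
-- * Construction: label v by {2^v, 2^v + 1} if v < qR and R ∣ v, else {2^v}.
--   Sums of two distinct powers of two determine the summands, so this is an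
--   IASI; its q heavy vertices are independent, so it is weak and its
--   mono-indexed edges are exactly the r(n − 2q) edges between light vertices.
module Submission where

open import Defs
open import Data.Nat using (ℕ; zero; suc; _+_; _*_; _∸_; _≤_; _<_; _⊔_; _%_; _/_; z≤n; s≤s; NonZero; _<?_)
import Data.Nat as ℕ
open import Data.Nat.Properties
open import Data.Nat.DivMod
open import Data.Nat.Tactic.RingSolver using (solve-∀)
open import Data.Bool using (Bool; true; false; not; _∧_; if_then_else_)
open import Data.Bool.Properties using (not-involutive)
open import Data.Fin using (Fin; toℕ)
import Data.Fin as Fin
open import Data.Fin.Properties using (toℕ-injective; toℕ<n; toℕ-fromℕ<)
open import Data.List using (List; []; _∷_; length; _++_; map)
open import Data.List.Properties using (length-map; length-++)
open import Data.List.Membership.Propositional using (_∈_)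
open import Data.List.Membership.Propositional.Properties using (∈-map⁻; ∈-++⁺ˡ; ∈-++⁺ʳ; ∈-++⁻)
open import Data.List.Relation.Unary.Any using (here; there)
open import Data.List.Relation.Unary.All using ([]; _∷_)
import Data.List.Relation.Unary.All as All
open import Data.List.Relation.Unary.AllPairs using ([]; _∷_)
open import Data.List.Relation.Unary.Unique.Propositional using (Unique)
import Data.List.Relation.Unary.Unique.Propositional.Properties as Unique
open import Data.Product using (Σ; ∃; _×_; _,_; proj₁; proj₂)
import Data.Product as Product
open import Data.Product.Properties using (≡-dec; ,-injectiveˡ; ,-injectiveʳ)
open import Data.Sum using (_⊎_; inj₁; inj₂)
import Data.Sum as Sum
open import Data.Empty using (⊥; ⊥-elim)
open import Relation.Nullary using (¬_; yes; no)
open import Relation.Binary.Definitions using (DecidableEquality; tri<; tri≈; tri>)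
open import Relation.Binary.PropositionalEquality

module _ {A : Set} (_≟_ : DecidableEquality A) where

  remove : A → List A → List A
  remove x [] = []
  remove x (y ∷ ys) with x ≟ y
  ... | yes _ = ys
  ... | no _ = y ∷ remove x ys

  length-remove : ∀ {x} ys → x ∈ ys → suc (length (remove x ys)) ≡ length ys
  length-remove {x} (y ∷ ys) p with x ≟ y
  ... | yes _ = refl
  length-remove {x} (y ∷ ys) (here x≡y) | no x≢y = ⊥-elim (x≢y x≡y)
  length-remove {x} (y ∷ ys) (there p) | no _ = cong suc (length-remove ys p)

  ∈-remove : ∀ {x z} ys → z ∈ ys → z ≢ x → z ∈ remove x ys
  ∈-remove {x} (y ∷ ys) p z≢x with x ≟ y
  ∈-remove {x} (y ∷ ys) (here refl) z≢x | yes refl = ⊥-elim (z≢x refl)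
  ∈-remove {x} (y ∷ ys) (there p) z≢x | yes refl = p
  ∈-remove {x} (y ∷ ys) (here p) z≢x | no _ = here p
  ∈-remove {x} (y ∷ ys) (there p) z≢x | no _ = there (∈-remove ys p z≢x)

  unique-⊆⇒length-≤ : ∀ {xs ys} → Unique xs → (∀ {z} → z ∈ xs → z ∈ ys) → length xs ≤ length ys
  unique-⊆⇒length-≤ {[]} _ _ = z≤n
  unique-⊆⇒length-≤ {x ∷ xs} {ys} (x∉xs ∷ u) xs⊆ys =
    subst (suc (length xs) ≤_) (length-remove ys (xs⊆ys (here refl)))
      (s≤s (unique-⊆⇒length-≤ u (λ z∈xs → ∈-remove ys (xs⊆ys (there z∈xs))
        (λ z≡x → All.lookup x∉xs z∈xs (sym z≡x)))))

,-injective : ∀ {A B : Set} {a c : A} {b d : B} → (a , b) ≡ (c , d) → a ≡ c × b ≡ d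
,-injective e = ,-injectiveˡ e , ,-injectiveʳ e

∧-true : ∀ {a b} → a ∧ b ≡ true → a ≡ true × b ≡ true
∧-true {true} {true} _ = refl , refl

not-true : ∀ {b} → not b ≡ true → b ≡ false
not-true {false} _ = refl

≐-sym : ∀ {A B} → SameSet A B → SameSet B A
≐-sym A≐B x = proj₂ (A≐B x) , proj₁ (A≐B x)

≐-trans : ∀ {A B C} → SameSet A B → SameSet B C → SameSet A C
≐-trans A≐B B≐C x = (λ a → proj₁ (B≐C x) (proj₁ (A≐B x) a)) , (λ c → proj₂ (A≐B x) (proj₂ (B≐C x) c))

≐-least : ∀ {A B a b} → (∀ x → A x → a ≤ x) → A a → (∀ x → B x → b ≤ x) → B b → SameSet A B → a ≡ b
≐-least {a = a} {b} A≥a Aa B≥b Bb A≐B = ≤-antisym (A≥a b (proj₂ (A≐B b) Bb)) (B≥b a (proj₁ (A≐B a) Aa))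

HasCard-unique : ∀ {A a b} → HasCard A a → HasCard A b → a ≡ b
HasCard-unique (xs , uxs , refl , xs≐A) (ys , uys , refl , ys≐A) =
  ≤-antisym (unique-⊆⇒length-≤ ℕ._≟_ uxs (λ {z} z∈xs → proj₁ (ys≐A z) (proj₂ (xs≐A z) z∈xs)))
            (unique-⊆⇒length-≤ ℕ._≟_ uys (λ {z} z∈ys → proj₁ (xs≐A z) (proj₂ (ys≐A z) z∈ys)))

HasCard-resp : ∀ {A B a} → SameSet A B → HasCard A a → HasCard B a
HasCard-resp A≐B (xs , u , l , xs≐A) = xs , u , l , ≐-trans (≐-sym A≐B) xs≐A

HasCard⇒NonEmpty⇒≥1 : ∀ {A k} → HasCard A k → NonEmpty A → 1 ≤ k
HasCard⇒NonEmpty⇒≥1 ([] , _ , refl , xs≐A) (x , Ax) with proj₁ (xs≐A x) Ax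
... | ()
HasCard⇒NonEmpty⇒≥1 ((_ ∷ _) , _ , refl , _) _ = s≤s z≤n

Sing : ℕ → SubsetN
Sing c x = x ≡ c

Pair : ℕ → SubsetN
Pair c x = x ≡ c ⊎ x ≡ suc c

HasCard-Sing : ∀ c → HasCard (Sing c) 1
HasCard-Sing c = (c ∷ []) , ([] ∷ []) , refl , λ x → (λ { refl → here refl }) , λ { (here p) → p }

HasCard-Pair : ∀ c → HasCard (Pair c) 2
HasCard-Pair c = (c ∷ suc c ∷ []) , ((c≢1+c ∷ []) ∷ [] ∷ []) , refl ,
  λ x → (λ { (inj₁ refl) → here refl ; (inj₂ refl) → there (here refl) }) ,
        (λ { (here p) → inj₁ p ; (there (here p)) → inj₂ p })
  where c≢1+c : c ≢ suc c
        c≢1+c ()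

HasCard-1⇒Sing : ∀ {A} → HasCard A 1 → ∃ λ c → SameSet A (Sing c)
HasCard-1⇒Sing ((c ∷ []) , _ , _ , xs≐A) =
  c , λ x → (λ Ax → from-singleton (proj₁ (xs≐A x) Ax)) , λ { refl → proj₂ (xs≐A c) (here refl) }
  where from-singleton : ∀ {x} → x ∈ (c ∷ []) → x ≡ c
        from-singleton (here p) = p

⊕-resp : ∀ {A A′ B B′} → SameSet A A′ → SameSet B B′ → SameSet (A ⊕ B) (A′ ⊕ B′)
⊕-resp A≐A′ B≐B′ x =
  (λ { (a , b , Aa , Bb , e) → a , b , proj₁ (A≐A′ a) Aa , proj₁ (B≐B′ b) Bb , e }) ,
  (λ { (a , b , Aa , Bb , e) → a , b , proj₂ (A≐A′ a) Aa , proj₂ (B≐B′ b) Bb , e })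

⊕-comm : ∀ A B → SameSet (A ⊕ B) (B ⊕ A)
⊕-comm A B x = swap , swap
  where swap : ∀ {C D} → (C ⊕ D) x → (D ⊕ C) x
        swap (a , b , Ca , Db , e) = b , a , Db , Ca , trans e (+-comm a b)

Sing⊕Sing : ∀ c d → SameSet (Sing c ⊕ Sing d) (Sing (c + d))
Sing⊕Sing c d x = (λ { (_ , _ , refl , refl , e) → e }) , λ e → c , d , refl , refl , e

Pair⊕Sing : ∀ c d → SameSet (Pair c ⊕ Sing d) (Pair (c + d))
Pair⊕Sing c d x =
  (λ { (_ , _ , inj₁ refl , refl , e) → inj₁ e ; (_ , _ , inj₂ refl , refl , e) → inj₂ e }) ,
  (λ { (inj₁ e) → c , d , inj₁ refl , refl , e ; (inj₂ e) → suc c , d , inj₂ refl , refl , e })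

Sing⊕Pair : ∀ c d → SameSet (Sing c ⊕ Pair d) (Pair (c + d))
Sing⊕Pair c d = subst (λ z → SameSet (Sing c ⊕ Pair d) (Pair z)) (+-comm d c)
  (≐-trans (⊕-comm (Sing c) (Pair d)) (Pair⊕Sing d c))

maximum : ℕ → List ℕ → ℕ
maximum x [] = x
maximum x (y ∷ ys) = x ⊔ maximum y ys

maximum-≥ : ∀ x ys {z} → z ∈ (x ∷ ys) → z ≤ maximum x ys
maximum-≥ x [] (here refl) = ≤-refl
maximum-≥ x (y ∷ ys) (here refl) = m≤m⊔n x _
maximum-≥ x (y ∷ ys) (there p) = ≤-trans (maximum-≥ y ys p) (m≤n⊔m x _)

maximum-∈ : ∀ x ys → maximum x ys ∈ (x ∷ ys)
maximum-∈ x [] = here refl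
maximum-∈ x (y ∷ ys) with ⊔-sel x (maximum y ys)
... | inj₁ e = here e
... | inj₂ e = there (subst (_∈ (y ∷ ys)) (sym e) (maximum-∈ y ys))

-- If B contains b₁ < b₂ then |A + B| ≥ |A| + 1: the sums a + b₁ (a ∈ A) are
-- distinct, and max A + b₂ exceeds all of them.
⊕-grows : ∀ {A B a c b₁ b₂} → HasCard A (suc a) → b₁ < b₂ → B b₁ → B b₂ →
          HasCard (A ⊕ B) c → suc (suc a) ≤ c
⊕-grows {A} {B} {a} {c} {b₁} {b₂} ((x ∷ xs) , u , refl , xs≐A) b₁<b₂ Bb₁ Bb₂ (zs , uz , refl , zs≐A⊕B) =
  subst (_≤ length zs) length-sums (unique-⊆⇒length-≤ ℕ._≟_ unique-sums sums⊆zs)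
  where
  top : ℕ
  top = maximum x xs
  sums : List ℕ
  sums = map (_+ b₁) (x ∷ xs) ++ (top + b₂ ∷ [])
  length-sums : length sums ≡ suc (length (x ∷ xs))
  length-sums = trans (length-++ (map (_+ b₁) (x ∷ xs)))
                      (trans (cong (_+ 1) (length-map (_+ b₁) (x ∷ xs))) (+-comm _ 1))
  unique-sums : Unique sums
  unique-sums = Unique.++⁺ (Unique.map⁺ (λ {p} {q} → +-cancelʳ-≡ b₁ p q) u) ([] ∷ [])
    (λ { (w+b₁∈ , here refl) → let (w , w∈ , e) = ∈-map⁻ (_+ b₁) w+b₁∈ in
         <-irrefl (sym e) (+-mono-≤-< (maximum-≥ x xs w∈) b₁<b₂) })
  sums⊆zs : ∀ {z} → z ∈ sums → z ∈ zs
  sums⊆zs {z} z∈ with ∈-++⁻ (map (_+ b₁) (x ∷ xs)) z∈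
  ... | inj₁ p = let (w , w∈ , e) = ∈-map⁻ (_+ b₁) p in
                 proj₁ (zs≐A⊕B z) (w , b₁ , proj₂ (xs≐A w) w∈ , Bb₁ , e)
  ... | inj₂ (here e) = proj₁ (zs≐A⊕B z) (top , b₂ , proj₂ (xs≐A top) (maximum-∈ x xs) , Bb₂ , e)

two-elements : ∀ {B b} → HasCard B b → 2 ≤ b → ∃ λ b₁ → ∃ λ b₂ → b₁ < b₂ × B b₁ × B b₂
two-elements ((_ ∷ []) , _ , refl , _) (s≤s ())
two-elements ((y₁ ∷ y₂ ∷ _) , ((y₁≢y₂ ∷ _) ∷ _) , refl , ys≐B) _ with <-cmp y₁ y₂
... | tri< lt _ _ = y₁ , y₂ , lt , proj₂ (ys≐B y₁) (here refl) , proj₂ (ys≐B y₂) (there (here refl))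
... | tri≈ _ eq _ = ⊥-elim (y₁≢y₂ eq)
... | tri> _ _ gt = y₂ , y₁ , gt , proj₂ (ys≐B y₂) (there (here refl)) , proj₂ (ys≐B y₁) (here refl)

¬weak-both-large : ∀ {A B a b} → HasCard A a → HasCard B b → 2 ≤ a → 2 ≤ b →
                   ¬ HasCard (A ⊕ B) (a ⊔ b)
¬weak-both-large {A} {B} {suc a} {suc b} hA hB 2≤a 2≤b hA⊕B
  with two-elements hA 2≤a | two-elements hB 2≤b | ⊔-sel (suc a) (suc b)
... | _ | b₁ , b₂ , lt , Bb₁ , Bb₂ | inj₁ e =
  <-irrefl (sym e) (⊕-grows hA lt Bb₁ Bb₂ hA⊕B)
... | a₁ , a₂ , lt , Aa₁ , Aa₂ | _ | inj₂ e =
  <-irrefl (sym e) (⊕-grows hB lt Aa₁ Aa₂ (HasCard-resp (⊕-comm A B) hA⊕B))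

-- 2^k, defined by doubling so that the parity arguments below are structural.
pow2 : ℕ → ℕ
pow2 zero = 1
pow2 (suc k) = pow2 k + pow2 k

odd≢even : ∀ p q → suc (p + p) ≢ q + q
odd≢even zero (suc q) e with trans (suc-injective e) (+-suc q q)
... | ()
odd≢even (suc p) (suc q) e rewrite +-suc p p | +-suc q q = odd≢even p q (suc-injective (suc-injective e))

double-injective : ∀ p q → p + p ≡ q + q → p ≡ q
double-injective zero zero e = refl
double-injective (suc p) (suc q) e rewrite +-suc p p | +-suc q q =
  cong suc (double-injective p q (suc-injective (suc-injective e)))

pow2-injective : ∀ a b → pow2 a ≡ pow2 b → a ≡ b
pow2-injective zero zero e = refl
pow2-injective zero (suc b) e = ⊥-elim (odd≢even 0 (pow2 b) e)
pow2-injective (suc a) zero e = ⊥-elim (odd≢even 0 (pow2 a) (sym e))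
pow2-injective (suc a) (suc b) e = cong suc (pow2-injective a b (double-injective _ _ e))

private
  interchange : ∀ a b → (a + a) + (b + b) ≡ (a + b) + (a + b)
  interchange = solve-∀

odd-pow2-sum : ∀ B x y → x ≢ y → suc (B + B) ≡ pow2 x + pow2 y →
               (x ≡ 0 × pow2 y ≡ B + B) ⊎ (y ≡ 0 × pow2 x ≡ B + B)
odd-pow2-sum B zero zero x≢y e = ⊥-elim (x≢y refl)
odd-pow2-sum B zero (suc y) x≢y e = inj₁ (refl , sym (suc-injective e))
odd-pow2-sum B (suc x) zero x≢y e = inj₂ (refl , sym (suc-injective (trans e (+-comm _ 1))))
odd-pow2-sum B (suc x) (suc y) x≢y e =
  ⊥-elim (odd≢even B (pow2 x + pow2 y) (trans e (interchange (pow2 x) (pow2 y))))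

pow2-sidon : ∀ a b x y → a ≢ b → x ≢ y → pow2 a + pow2 b ≡ pow2 x + pow2 y →
             (a ≡ x × b ≡ y) ⊎ (a ≡ y × b ≡ x)
pow2-sidon zero zero x y a≢b x≢y e = ⊥-elim (a≢b refl)
pow2-sidon zero (suc b) x y a≢b x≢y e with odd-pow2-sum (pow2 b) x y x≢y e
... | inj₁ (x≡0 , py) = inj₁ (sym x≡0 , pow2-injective (suc b) y (sym py))
... | inj₂ (y≡0 , px) = inj₂ (sym y≡0 , pow2-injective (suc b) x (sym px))
pow2-sidon (suc a) zero x y a≢b x≢y e with odd-pow2-sum (pow2 a) x y x≢y (trans (+-comm 1 _) e)
... | inj₁ (x≡0 , py) = inj₂ (pow2-injective (suc a) y (sym py) , sym x≡0)
... | inj₂ (y≡0 , px) = inj₁ (pow2-injective (suc a) x (sym px) , sym y≡0)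
pow2-sidon (suc a) (suc b) zero zero a≢b x≢y e = ⊥-elim (x≢y refl)
pow2-sidon (suc a) (suc b) zero (suc y) a≢b x≢y e =
  ⊥-elim (odd≢even (pow2 y) (pow2 a + pow2 b) (sym (trans (sym (interchange (pow2 a) (pow2 b))) e)))
pow2-sidon (suc a) (suc b) (suc x) zero a≢b x≢y e =
  ⊥-elim (odd≢even (pow2 x) (pow2 a + pow2 b)
    (sym (trans (sym (interchange (pow2 a) (pow2 b))) (trans e (+-comm _ 1)))))
pow2-sidon (suc a) (suc b) (suc x) (suc y) a≢b x≢y e =
  Sum.map (λ { (p , q) → cong suc p , cong suc q }) (λ { (p , q) → cong suc p , cong suc q })
    (pow2-sidon a b x y (λ p → a≢b (cong suc p)) (λ p → x≢y (cong suc p))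
      (double-injective _ _ (trans (sym (interchange (pow2 a) (pow2 b))) (trans e (interchange (pow2 x) (pow2 y))))))

sumBelow : (ℕ → ℕ) → ℕ → ℕ
sumBelow f zero = 0
sumBelow f (suc k) = f 0 + sumBelow (λ j → f (suc j)) k

𝟙 : Bool → ℕ
𝟙 true = 1
𝟙 false = 0

sumBelow-cong : ∀ {f g} k → (∀ j → j < k → f j ≡ g j) → sumBelow f k ≡ sumBelow g k
sumBelow-cong zero _ = refl
sumBelow-cong (suc k) f≡g = cong₂ _+_ (f≡g 0 (s≤s z≤n)) (sumBelow-cong k (λ j j<k → f≡g (suc j) (s≤s j<k)))

sumBelow-mono-≤ : ∀ {f g} k → (∀ j → j < k → f j ≤ g j) → sumBelow f k ≤ sumBelow g k
sumBelow-mono-≤ zero _ = z≤n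
sumBelow-mono-≤ (suc k) f≤g = +-mono-≤ (f≤g 0 (s≤s z≤n)) (sumBelow-mono-≤ k (λ j j<k → f≤g (suc j) (s≤s j<k)))

sumBelow-const : ∀ c k → sumBelow (λ _ → c) k ≡ k * c
sumBelow-const c zero = refl
sumBelow-const c (suc k) = cong (c +_) (sumBelow-const c k)

sumBelow-zero : ∀ {f} k → (∀ j → j < k → f j ≡ 0) → sumBelow f k ≡ 0
sumBelow-zero k f≡0 = trans (sumBelow-cong k f≡0) (trans (sumBelow-const 0 k) (*-zeroʳ k))

sumBelow-split : ∀ f a b → sumBelow f (a + b) ≡ sumBelow f a + sumBelow (λ j → f (a + j)) b
sumBelow-split f zero b = refl
sumBelow-split f (suc a) b =
  trans (cong (f 0 +_) (sumBelow-split (λ j → f (suc j)) a b)) (sym (+-assoc (f 0) _ _))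

sumBelow-+ : ∀ f g k → sumBelow (λ j → f j + g j) k ≡ sumBelow f k + sumBelow g k
sumBelow-+ f g zero = refl
sumBelow-+ f g (suc k) rewrite sumBelow-+ (λ j → f (suc j)) (λ j → g (suc j)) k = shuffle (f 0) (g 0) _ _
  where shuffle : ∀ a b c d → (a + b) + (c + d) ≡ (a + c) + (b + d)
        shuffle = solve-∀

sumBelow-swap : ∀ (g : ℕ → ℕ → ℕ) a b →
  sumBelow (λ i → sumBelow (λ j → g i j) b) a ≡ sumBelow (λ j → sumBelow (λ i → g i j) a) b
sumBelow-swap g zero b = sym (sumBelow-zero b (λ _ _ → refl))
sumBelow-swap g (suc a) b =
  trans (cong (sumBelow (g 0) b +_) (sumBelow-swap (λ i → g (suc i)) a b))
        (sym (sumBelow-+ (g 0) (λ j → sumBelow (λ i → g (suc i) j) a) b))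

sumBelow-rotate : ∀ n {{_ : NonZero n}} d (g : ℕ → ℕ) → d ≤ n →
                  sumBelow (λ v → g ((v + d) % n)) n ≡ sumBelow g n
sumBelow-rotate n d g d≤n = begin
  sumBelow h n                                                 ≡⟨ cong (sumBelow h) (sym (m∸n+n≡m d≤n)) ⟩
  sumBelow h (n ∸ d + d)                                       ≡⟨ sumBelow-split h (n ∸ d) d ⟩
  sumBelow h (n ∸ d) + sumBelow (λ j → h (n ∸ d + j)) d        ≡⟨ cong₂ _+_ (sumBelow-cong (n ∸ d) unwrapped)
                                                                            (sumBelow-cong d wrapped) ⟩
  sumBelow (λ j → g (d + j)) (n ∸ d) + sumBelow g d            ≡⟨ +-comm _ (sumBelow g d) ⟩
  sumBelow g d + sumBelow (λ j → g (d + j)) (n ∸ d)            ≡⟨ sym (sumBelow-split g d (n ∸ d)) ⟩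
  sumBelow g (d + (n ∸ d))                                     ≡⟨ cong (sumBelow g) (m+[n∸m]≡n d≤n) ⟩
  sumBelow g n                                                 ∎
  where
  open ≡-Reasoning
  h : ℕ → ℕ
  h v = g ((v + d) % n)
  unwrapped : ∀ j → j < n ∸ d → h j ≡ g (d + j)
  unwrapped j j<n∸d =
    cong g (trans (m<n⇒m%n≡m (subst (j + d <_) (m∸n+n≡m d≤n) (+-monoˡ-< d j<n∸d))) (+-comm j d))
  wrapped : ∀ j → j < d → h (n ∸ d + j) ≡ g j
  wrapped j j<d = cong g (trans (cong (_% n) (rearrange j)) (trans ([m+n]%n≡m%n j n) (m<n⇒m%n≡m (<-≤-trans j<d d≤n))))
    where rearrange : ∀ j → n ∸ d + j + d ≡ j + n
          rearrange j = trans (+-assoc (n ∸ d) j d) (trans (cong (n ∸ d +_) (+-comm j d))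
            (trans (sym (+-assoc (n ∸ d) d j)) (trans (cong (_+ j) (m∸n+n≡m d≤n)) (+-comm n j))))

sumBelow-sparse : ∀ (P : ℕ → Bool) k →
  (∀ j₁ j₂ → j₁ < j₂ → j₂ < k → P j₁ ≡ true → P j₂ ≡ true → ⊥) → sumBelow (λ j → 𝟙 (P j)) k ≤ 1
sumBelow-sparse P zero _ = z≤n
sumBelow-sparse P (suc k) sparse with P 0 in P0
... | true = s≤s (≤-reflexive (sumBelow-zero k rest-false))
  where rest-false : ∀ j → j < k → 𝟙 (P (suc j)) ≡ 0
        rest-false j j<k with P (suc j) in Pj
        ... | true = ⊥-elim (sparse 0 (suc j) (s≤s z≤n) (s≤s j<k) P0 Pj)
        ... | false = refl
... | false = sumBelow-sparse (λ j → P (suc j)) k (λ j₁ j₂ lt j₂<k → sparse (suc j₁) (suc j₂) (s≤s lt) (s≤s j₂<k))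

module _ {A : Set} where

  select : (ℕ → Bool) → (ℕ → A) → ℕ → List A
  select g h zero = []
  select g h (suc k) with g 0
  ... | true = h 0 ∷ select (λ j → g (suc j)) (λ j → h (suc j)) k
  ... | false = select (λ j → g (suc j)) (λ j → h (suc j)) k

  length-select : ∀ g h k → length (select g h k) ≡ sumBelow (λ j → 𝟙 (g j)) k
  length-select g h zero = refl
  length-select g h (suc k) with g 0
  ... | true = cong suc (length-select (λ j → g (suc j)) (λ j → h (suc j)) k)
  ... | false = length-select (λ j → g (suc j)) (λ j → h (suc j)) k

  ∈-select⁻ : ∀ {x} g h k → x ∈ select g h k → Σ ℕ λ j → j < k × g j ≡ true × x ≡ h j
  ∈-select⁻ g h (suc k) x∈ with g 0 in g0 | x∈
  ... | true | here x≡ = 0 , s≤s z≤n , g0 , x≡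
  ... | true | there x∈′ = let (j , j<k , gj , x≡) = ∈-select⁻ (λ j → g (suc j)) (λ j → h (suc j)) k x∈′
                           in suc j , s≤s j<k , gj , x≡
  ... | false | x∈′ = let (j , j<k , gj , x≡) = ∈-select⁻ (λ j → g (suc j)) (λ j → h (suc j)) k x∈′
                      in suc j , s≤s j<k , gj , x≡

  ∈-select⁺ : ∀ g h k {j} → j < k → g j ≡ true → h j ∈ select g h k
  ∈-select⁺ g h (suc k) {j} j<k gj with g 0 in g0
  ∈-select⁺ g h (suc k) {zero} _ gj | true = here refl
  ∈-select⁺ g h (suc k) {suc j} (s≤s j<k) gj | true = there (∈-select⁺ (λ j → g (suc j)) (λ j → h (suc j)) k j<k gj)
  ∈-select⁺ g h (suc k) {zero} _ gj | false with () ← trans (sym gj) g0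
  ∈-select⁺ g h (suc k) {suc j} (s≤s j<k) gj | false = ∈-select⁺ (λ j → g (suc j)) (λ j → h (suc j)) k j<k gj

  select-unique : ∀ g h k → (∀ {i j} → i < k → j < k → g i ≡ true → g j ≡ true → h i ≡ h j → i ≡ j) →
                  Unique (select g h k)
  select-unique g h zero _ = []
  select-unique g h (suc k) inj with g 0 in g0
  ... | true = All.tabulate (λ x∈ hx≡ → fresh x∈ hx≡) ∷ rest
    where
    rest : Unique (select (λ j → g (suc j)) (λ j → h (suc j)) k)
    rest = select-unique (λ j → g (suc j)) (λ j → h (suc j)) k
             (λ i<k j<k gi gj e → suc-injective (inj (s≤s i<k) (s≤s j<k) gi gj e))
    fresh : ∀ {x} → x ∈ select (λ j → g (suc j)) (λ j → h (suc j)) k → h 0 ≡ x → ⊥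
    fresh x∈ h0≡x with ∈-select⁻ (λ j → g (suc j)) (λ j → h (suc j)) k x∈
    ... | j , j<k , gj , x≡ with () ← inj (s≤s z≤n) (s≤s j<k) g0 gj (trans h0≡x x≡)
  ... | false = select-unique (λ j → g (suc j)) (λ j → h (suc j)) k
                  (λ i<k j<k gi gj e → suc-injective (inj (s≤s i<k) (s≤s j<k) gi gj e))

module Modular (n : ℕ) {{_ : NonZero n}} where

  infix 4 _≋_
  _≋_ : ℕ → ℕ → Set
  a ≋ b = a % n ≡ b % n

  ≋-refl : ∀ {a} → a ≋ a
  ≋-refl = refl

  ≋-sym : ∀ {a b} → a ≋ b → b ≋ a
  ≋-sym = sym

  ≋-trans : ∀ {a b c} → a ≋ b → b ≋ c → a ≋ c
  ≋-trans = trans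

  ≡⇒≋ : ∀ {a b} → a ≡ b → a ≋ b
  ≡⇒≋ = cong (_% n)

  %-≋ : ∀ a → a % n ≋ a
  %-≋ a = m%n%n≡m%n a n

  ≋-+ : ∀ {a b c d} → a ≋ b → c ≋ d → a + c ≋ b + d
  ≋-+ {a} {b} {c} {d} a≋b c≋d = begin
    (a + c) % n              ≡⟨ %-distribˡ-+ a c n ⟩
    (a % n + c % n) % n      ≡⟨ cong₂ (λ x y → (x + y) % n) a≋b c≋d ⟩
    (b % n + d % n) % n      ≡⟨ %-distribˡ-+ b d n ⟨
    (b + d) % n              ∎
    where open ≡-Reasoning

  ≋-+ʳ : ∀ {a b} c → a ≋ b → a + c ≋ b + c
  ≋-+ʳ c a≋b = ≋-+ a≋b (≋-refl {c})

  ≋-undo : ∀ a c → a ≋ (a + c) + (n ∸ c % n)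
  ≋-undo a c = begin
    a % n                         ≡⟨ [m+n]%n≡m%n a n ⟨
    (a + n) % n                   ≡⟨ ≡⇒≋ a+n≡ ⟩
    (a + c % n + (n ∸ c % n)) % n ≡⟨ ≋-+ʳ (n ∸ c % n) (≋-+ (≋-refl {a}) (%-≋ c)) ⟩
    (a + c + (n ∸ c % n)) % n     ∎
    where
    open ≡-Reasoning
    a+n≡ : a + n ≡ a + c % n + (n ∸ c % n)
    a+n≡ = trans (cong (a +_) (sym (m+[n∸m]≡n (m%n≤n c n)))) (sym (+-assoc a (c % n) _))

  ≋-cancel-+ʳ : ∀ {a b} c → a + c ≋ b + c → a ≋ b
  ≋-cancel-+ʳ {a} {b} c e = ≋-trans (≋-undo a c) (≋-trans (≋-+ʳ (n ∸ c % n) e) (≋-sym (≋-undo b c)))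

  ≋⇒≡ : ∀ {a b} → a < n → b < n → a ≋ b → a ≡ b
  ≋⇒≡ a<n b<n e = trans (sym (m<n⇒m%n≡m a<n)) (trans e (m<n⇒m%n≡m b<n))

  +-suc-1 : ∀ a d → a + suc d ≡ (a + d) + 1
  +-suc-1 a d = trans (+-suc a d) (+-comm 1 (a + d))

  Offset : ℕ → ℕ → ℕ → Set
  Offset x z k = Σ ℕ λ d → d ≤ k × (x + d ≋ z ⊎ z + d ≋ x)

  offset-step : ∀ {x y z k} → (x + 1 ≋ y ⊎ y + 1 ≋ x) → Offset y z k → Offset x z (suc k)
  offset-step {x} {y} {z} (inj₁ fwd) (d , d≤k , inj₁ y+d≋z) =
    suc d , s≤s d≤k , inj₁ (≋-trans (≡⇒≋ (sym (+-assoc x 1 d))) (≋-trans (≋-+ʳ d fwd) y+d≋z))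
  offset-step {x} {y} {z} (inj₂ bwd) (d , d≤k , inj₂ z+d≋y) =
    suc d , s≤s d≤k , inj₂ (≋-trans (≡⇒≋ (+-suc-1 z d)) (≋-trans (≋-+ʳ 1 z+d≋y) bwd))
  offset-step {x} {y} {z} (inj₁ fwd) (zero , _ , inj₂ z+0≋y) =
    1 , s≤s z≤n , inj₁ (≋-trans fwd (≋-trans (≋-sym z+0≋y) (≡⇒≋ (+-identityʳ z))))
  offset-step {x} {y} {z} (inj₁ fwd) (suc d , d≤k , inj₂ z+d≋y) =
    d , ≤-trans (n≤1+n d) (m≤n⇒m≤1+n d≤k) ,
    inj₂ (≋-cancel-+ʳ 1 (≋-trans (≡⇒≋ (sym (+-suc-1 z d))) (≋-trans z+d≋y (≋-sym fwd))))
  offset-step {x} {y} {z} (inj₂ bwd) (zero , _ , inj₁ y+0≋z) =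
    1 , s≤s z≤n , inj₂ (≋-trans (≋-+ʳ 1 (≋-trans (≋-sym y+0≋z) (≡⇒≋ (+-identityʳ y)))) bwd)
  offset-step {x} {y} {z} (inj₂ bwd) (suc d , d≤k , inj₁ y+d≋z) =
    d , ≤-trans (n≤1+n d) (m≤n⇒m≤1+n d≤k) ,
    inj₁ (≋-trans (≋-+ʳ d (≋-sym bwd)) (≋-trans (≡⇒≋ (+-assoc y 1 d)) y+d≋z))

module CyclePower (n r : ℕ) {{_ : NonZero n}} (2r<n : r + r < n) where
  open Modular n public

  C : Graph
  C = Cycle n

  G : Graph
  G = Power C r

  r<n : r < n
  r<n = ≤-trans (s≤s (m≤m+n r r)) 2r<n

  ι : ℕ → Fin n
  ι v = v mod n

  toℕ-ι : ∀ v → toℕ (ι v) ≡ v % n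
  toℕ-ι v = toℕ-fromℕ< (m%n<n v n)

  toℕ-ι-< : ∀ {v} → v < n → toℕ (ι v) ≡ v
  toℕ-ι-< v<n = trans (toℕ-ι _) (m<n⇒m%n≡m v<n)

  ι-toℕ : (u : Fin n) → ι (toℕ u) ≡ u
  ι-toℕ u = toℕ-injective (toℕ-ι-< (toℕ<n u))

  ι-≋ : ∀ {a b} → a ≋ b → ι a ≡ ι b
  ι-≋ {a} {b} e = toℕ-injective (trans (toℕ-ι a) (trans e (sym (toℕ-ι b))))

  ι≡⇒≋ : ∀ {a b} → ι a ≡ ι b → a ≋ b
  ι≡⇒≋ {a} {b} e = trans (sym (toℕ-ι a)) (trans (cong toℕ e) (toℕ-ι b))

  toℕ-% : (u : Fin n) → toℕ u % n ≡ toℕ u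
  toℕ-% u = m<n⇒m%n≡m (toℕ<n u)

  shift : ℕ → ℕ → ℕ
  shift d v = (v + d) % n

  succ-≋ : ∀ {x y} → CycSucc n x y → toℕ x + 1 ≋ toℕ y
  succ-≋ {x} {y} (inj₁ y≡1+x) = cong (_% n) (trans (+-comm (toℕ x) 1) (sym y≡1+x))
  succ-≋ {x} {y} (inj₂ (y≡0 , 1+x≡n)) =
    trans (cong (_% n) (trans (+-comm (toℕ x) 1) 1+x≡n)) (trans (n%n≡0 n) (trans (sym y≡0) (sym (toℕ-% y))))

  adj-≋ : ∀ {x y} → Adj C x y → toℕ x + 1 ≋ toℕ y ⊎ toℕ y + 1 ≋ toℕ x
  adj-≋ (inj₁ s) = inj₁ (succ-≋ s)
  adj-≋ (inj₂ s) = inj₂ (succ-≋ s)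

  walk⇒offset : ∀ {u v k} → Walk C u v k → Offset (toℕ u) (toℕ v) k
  walk⇒offset nil = 0 , z≤n , inj₁ (≡⇒≋ (+-identityʳ _))
  walk⇒offset (cons a w) = offset-step (adj-≋ a) (walk⇒offset w)

  step : (u : Fin n) → CycSucc n u (ι (toℕ u + 1))
  step u with toℕ u + 1 <? n
  ... | yes lt = inj₁ (trans (toℕ-ι-< lt) (+-comm (toℕ u) 1))
  ... | no ≮ = inj₂ (trans (toℕ-ι _) (trans (cong (_% n) u+1≡n) (n%n≡0 n)) , trans (+-comm 1 (toℕ u)) u+1≡n)
    where u+1≡n : toℕ u + 1 ≡ n
          u+1≡n = ≤-antisym (subst (_≤ n) (+-comm 1 (toℕ u)) (toℕ<n u)) (≮⇒≥ ≮)

  walk-clockwise : (u : Fin n) (d : ℕ) → Walk C u (ι (toℕ u + d)) d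
  walk-clockwise u zero = subst (λ z → Walk C u z 0) (sym (trans (cong ι (+-identityʳ (toℕ u))) (ι-toℕ u))) nil
  walk-clockwise u (suc d) = cons (inj₁ (step u)) (subst (λ z → Walk C w z d) same-end (walk-clockwise w d))
    where
    w : Fin n
    w = ι (toℕ u + 1)
    same-end : ι (toℕ w + d) ≡ ι (toℕ u + suc d)
    same-end = ι-≋ (≋-trans (≋-+ʳ d (≋-trans (≡⇒≋ (toℕ-ι _)) (%-≋ _))) (≡⇒≋ (+-assoc (toℕ u) 1 d)))

  reverse : ∀ {u v k} → Walk C u v k → Walk C v u k
  reverse nil = nil
  reverse (cons a w) = snoc (reverse w) (Sum.swap a)
    where snoc : ∀ {u v x k} → Walk C u v k → Adj C v x → Walk C u x (suc k)
          snoc nil a = cons a nil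
          snoc (cons b w) a = cons b (snoc w a)

  G-sym : ∀ {u v} → Adj G u v → Adj G v u
  G-sym (u≢v , k , k≤r , w) = (λ e → u≢v (sym e)) , k , k≤r , reverse w

  shift-moves : ∀ v d → 1 ≤ d → d < n → v ≋ v + d → ⊥
  shift-moves v d 1≤d d<n v≋v+d = <-irrefl (sym d≡0) 1≤d
    where d≡0 : d ≡ 0
          d≡0 = ≋⇒≡ d<n (≤-trans (s≤s z≤n) d<n) (≋-sym (≋-cancel-+ʳ v (subst (v ≋_) (+-comm v d) v≋v+d)))

  adj-shift : ∀ v d → 1 ≤ d → d ≤ r → Adj G (ι v) (ι (shift d v))
  adj-shift v d 1≤d d≤r = distinct , d , d≤r , subst (λ z → Walk C (ι v) z d) same-end (walk-clockwise (ι v) d)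
    where
    v≋ : toℕ (ι v) ≋ v
    v≋ = ≋-trans (≡⇒≋ (toℕ-ι v)) (%-≋ v)
    same-end : ι (toℕ (ι v) + d) ≡ ι (shift d v)
    same-end = ι-≋ (≋-trans (≋-+ʳ d v≋) (≋-sym (%-≋ (v + d))))
    distinct : ι v ≢ ι (shift d v)
    distinct e = shift-moves v d 1≤d (≤-<-trans d≤r r<n) (≋-trans (ι≡⇒≋ e) (%-≋ (v + d)))

  adj⇒shift : ∀ {u v} → Adj G u v → Σ ℕ λ d → 1 ≤ d × d ≤ r ×
              (shift d (toℕ u) ≡ toℕ v ⊎ shift d (toℕ v) ≡ toℕ u)
  adj⇒shift {u} {v} (u≢v , k , k≤r , w) with walk⇒offset w
  ... | zero , _ , inj₁ e = ⊥-elim (u≢v (toℕ-injective (≋⇒≡ (toℕ<n u) (toℕ<n v) (≋-trans (≡⇒≋ (sym (+-identityʳ _))) e))))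
  ... | zero , _ , inj₂ e = ⊥-elim (u≢v (toℕ-injective (≋⇒≡ (toℕ<n u) (toℕ<n v) (≋-sym (≋-trans (≡⇒≋ (sym (+-identityʳ _))) e)))))
  ... | suc d , d<k , e = suc d , s≤s z≤n , ≤-trans d<k k≤r , Sum.map (λ e → trans e (toℕ-% v)) (λ e → trans e (toℕ-% u)) e

  -- Edges are recorded as pairs sorted by vertex index, as in MonoEdge.
  sortPair : Fin n → Fin n → Fin n × Fin n
  sortPair a b with toℕ a <? toℕ b
  ... | yes _ = a , b
  ... | no _ = b , a

  sortPair-sorted : ∀ {a b} → toℕ a < toℕ b → sortPair a b ≡ (a , b)
  sortPair-sorted {a} {b} a<b with toℕ a <? toℕ b
  ... | yes _ = refl
  ... | no a≮b = ⊥-elim (a≮b a<b)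

  sortPair-comm : ∀ a b → sortPair a b ≡ sortPair b a
  sortPair-comm a b with toℕ a <? toℕ b | toℕ b <? toℕ a
  ... | yes _ | no _ = refl
  ... | no _ | yes _ = refl
  ... | yes a<b | yes b<a = ⊥-elim (<-asym a<b b<a)
  ... | no a≮b | no b≮a = cong₂ _,_ b≡a (sym b≡a)
    where b≡a : b ≡ a
          b≡a = toℕ-injective (≤-antisym (≮⇒≥ a≮b) (≮⇒≥ b≮a))

  sortPair-cases : ∀ a b → (sortPair a b ≡ (a , b) × toℕ a < toℕ b) ⊎ (sortPair a b ≡ (b , a) × ¬ toℕ a < toℕ b)
  sortPair-cases a b with toℕ a <? toℕ b
  ... | yes a<b = inj₁ (refl , a<b)
  ... | no a≮b = inj₂ (refl , a≮b)

  sortPair-injective : ∀ {a b c d} → sortPair a b ≡ sortPair c d → (a ≡ c × b ≡ d) ⊎ (a ≡ d × b ≡ c)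
  sortPair-injective {a} {b} {c} {d} e with sortPair-cases a b | sortPair-cases c d
  ... | inj₁ (p , _) | inj₁ (q , _) = inj₁ (,-injective (trans (sym p) (trans e q)))
  ... | inj₁ (p , _) | inj₂ (q , _) = inj₂ (,-injective (trans (sym p) (trans e q)))
  ... | inj₂ (p , _) | inj₁ (q , _) = inj₂ (Product.swap (,-injective (trans (sym p) (trans e q))))
  ... | inj₂ (p , _) | inj₂ (q , _) = inj₁ (Product.swap (,-injective (trans (sym p) (trans e q))))

  sortPair-MonoEdge : ∀ (f : Fin n → SubsetN) {a b} → Adj G a b → HasCard (f a ⊕ f b) 1 →
                      MonoEdge G f (proj₁ (sortPair a b)) (proj₂ (sortPair a b))
  sortPair-MonoEdge f {a} {b} ab card with sortPair-cases a b
  ... | inj₁ (p , a<b) = subst (λ e → MonoEdge G f (proj₁ e) (proj₂ e)) (sym p) (a<b , ab , card)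
  ... | inj₂ (p , a≮b) = subst (λ e → MonoEdge G f (proj₁ e) (proj₂ e)) (sym p)
          (b<a , G-sym ab , HasCard-resp (⊕-comm (f a) (f b)) card)
    where b<a : toℕ b < toℕ a
          b<a = ≤∧≢⇒< (≮⇒≥ a≮b) (λ e → proj₁ ab (toℕ-injective (sym e)))

  edge : ℕ → ℕ → Fin n × Fin n
  edge d v = sortPair (ι v) (ι (shift d v))

  -- Since 2r < n, distinct (d, v) with 1 ≤ d ≤ r, v < n give distinct edges.
  edge-injective : ∀ {d v d′ v′} → 1 ≤ d → d ≤ r → 1 ≤ d′ → d′ ≤ r → v < n → v′ < n →
                   edge d v ≡ edge d′ v′ → d ≡ d′ × v ≡ v′
  edge-injective {d} {v} {d′} {v′} 1≤d d≤r 1≤d′ d′≤r v<n v′<n e with sortPair-injective e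
  ... | inj₁ (v≡ , w≡) = d≡d′ , v≡v′
    where
    v≡v′ : v ≡ v′
    v≡v′ = ≋⇒≡ v<n v′<n (ι≡⇒≋ v≡)
    d≡d′ : d ≡ d′
    d≡d′ = ≋⇒≡ (≤-<-trans d≤r r<n) (≤-<-trans d′≤r r<n)
      (≋-cancel-+ʳ v (subst₂ _≋_ (+-comm v d) (trans (cong (_+ d′) (sym v≡v′)) (+-comm v d′))
        (≋-trans (≋-sym (%-≋ (v + d))) (≋-trans (ι≡⇒≋ w≡) (%-≋ (v′ + d′))))))
  ... | inj₂ (v≡ , w≡) = ⊥-elim (shift-moves v′ (d′ + d) (≤-trans 1≤d′ (m≤m+n d′ d))
          (≤-<-trans (+-mono-≤ d′≤r d≤r) 2r<n) (≋-sym round-trip))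
    where
    round-trip : v′ + (d′ + d) ≋ v′
    round-trip = ≋-trans (≡⇒≋ (sym (+-assoc v′ d′ d)))
      (≋-trans (≋-+ʳ d (≋-trans (≋-sym (%-≋ (v′ + d′))) (≋-sym (ι≡⇒≋ v≡))))
        (≋-trans (≋-sym (%-≋ (v + d))) (ι≡⇒≋ w≡)))

  -- Given which vertices are "light" (singleton-labelled), list the edges
  -- of C_n^r with both ends light, row by row.
  module LightEdges (light : ℕ → Bool) where

    bothLight : ℕ → ℕ → Bool
    bothLight d v = light v ∧ light (shift d v)

    row : ℕ → List (Fin n × Fin n)
    row d = select (bothLight d) (edge d) n

    rows : ℕ → List (Fin n × Fin n)
    rows zero = []
    rows (suc D) = row (suc D) ++ rows D

    length-row : ∀ d → length (row d) ≡ sumBelow (λ v → 𝟙 (bothLight d v)) n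
    length-row d = length-select (bothLight d) (edge d) n

    ∈-rows⁻ : ∀ {e} D → e ∈ rows D →
              Σ ℕ λ d → Σ ℕ λ v → 1 ≤ d × d ≤ D × v < n × bothLight d v ≡ true × e ≡ edge d v
    ∈-rows⁻ (suc D) e∈ with ∈-++⁻ (row (suc D)) e∈
    ... | inj₁ e∈row = let (v , v<n , lit , e≡) = ∈-select⁻ (bothLight (suc D)) (edge (suc D)) n e∈row
                       in suc D , v , s≤s z≤n , ≤-refl , v<n , lit , e≡
    ... | inj₂ e∈rows = let (d , v , 1≤d , d≤D , v<n , lit , e≡) = ∈-rows⁻ D e∈rows
                        in d , v , 1≤d , m≤n⇒m≤1+n d≤D , v<n , lit , e≡

    ∈-rows⁺ : ∀ D {d v} → 1 ≤ d → d ≤ D → v < n → bothLight d v ≡ true → edge d v ∈ rows D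
    ∈-rows⁺ zero (s≤s _) () _ _
    ∈-rows⁺ (suc D) {d} 1≤d d≤D v<n lit with m≤n⇒m<n∨m≡n d≤D
    ... | inj₂ refl = ∈-++⁺ˡ (∈-select⁺ (bothLight d) (edge d) n v<n lit)
    ... | inj₁ (s≤s d≤D′) = ∈-++⁺ʳ (row (suc D)) (∈-rows⁺ D 1≤d d≤D′ v<n lit)

    rows-unique : ∀ D → D ≤ r → Unique (rows D)
    rows-unique zero _ = []
    rows-unique (suc D) D<r = Unique.++⁺ row-unique (rows-unique D (≤-trans (n≤1+n D) D<r)) disjoint
      where
      row-unique : Unique (row (suc D))
      row-unique = select-unique (bothLight (suc D)) (edge (suc D)) n
        (λ i<n j<n _ _ e → proj₂ (edge-injective (s≤s z≤n) D<r (s≤s z≤n) D<r i<n j<n e))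
      disjoint : ∀ {e} → e ∈ row (suc D) × e ∈ rows D → ⊥
      disjoint (e∈row , e∈rows) with ∈-select⁻ (bothLight (suc D)) (edge (suc D)) n e∈row | ∈-rows⁻ D e∈rows
      ... | v , v<n , _ , e≡ | d , w , 1≤d , d≤D , w<n , _ , e≡′ =
        <-irrefl (sym (proj₁ (edge-injective (s≤s z≤n) D<r 1≤d (≤-trans (m≤n⇒m≤1+n d≤D) D<r) v<n w<n (trans (sym e≡) e≡′))))
                 (s≤s d≤D)

    rows-mono : ∀ (f : Fin n → SubsetN) → (∀ v → v < n → light v ≡ true → ∃ λ c → SameSet (f (ι v)) (Sing c)) →
                ∀ {e} → e ∈ rows r → MonoEdge G f (proj₁ e) (proj₂ e)
    rows-mono f light⇒singleton e∈ with ∈-rows⁻ r e∈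
    ... | d , v , 1≤d , d≤r , v<n , lit , refl
        with light⇒singleton v v<n (proj₁ (∧-true lit))
           | light⇒singleton (shift d v) (m%n<n (v + d) n) (proj₂ (∧-true lit))
    ... | c₁ , f≐c₁ | c₂ , f≐c₂ =
      sortPair-MonoEdge f (adj-shift v d 1≤d d≤r)
        (HasCard-resp (≐-sym (≐-trans (⊕-resp f≐c₁ f≐c₂) (Sing⊕Sing c₁ c₂))) (HasCard-Sing (c₁ + c₂)))

    adj⇒∈rows : ∀ {u v} → Adj G u v → toℕ u < toℕ v → light (toℕ u) ≡ true → light (toℕ v) ≡ true → (u , v) ∈ rows r
    adj⇒∈rows {u} {v} uv u<v lu lv with adj⇒shift uv
    ... | d , 1≤d , d≤r , inj₁ u+d≡v = subst (_∈ rows r) edge≡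
            (∈-rows⁺ r 1≤d d≤r (toℕ<n u) (cong₂ _∧_ lu (trans (cong light u+d≡v) lv)))
      where edge≡ : edge d (toℕ u) ≡ (u , v)
            edge≡ = trans (cong₂ sortPair (ι-toℕ u) (trans (cong ι u+d≡v) (ι-toℕ v))) (sortPair-sorted u<v)
    ... | d , 1≤d , d≤r , inj₂ v+d≡u = subst (_∈ rows r) edge≡
            (∈-rows⁺ r 1≤d d≤r (toℕ<n v) (cong₂ _∧_ lv (trans (cong light v+d≡u) lu)))
      where edge≡ : edge d (toℕ v) ≡ (u , v)
            edge≡ = trans (cong₂ sortPair (ι-toℕ v) (trans (cong ι v+d≡u) (ι-toℕ u)))
                          (trans (sortPair-comm v u) (sortPair-sorted u<v))

  HeavyIndependent : (ℕ → Bool) → Set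
  HeavyIndependent light = ∀ v d → v < n → 1 ≤ d → d ≤ r → light v ≡ false → light (shift d v) ≡ false → ⊥

  module Counting (light : ℕ → Bool) (independent : HeavyIndependent light) where
    open LightEdges light public

    heavy : ℕ → ℕ
    heavy v = 𝟙 (not (light v))

    heavyCount : ℕ
    heavyCount = sumBelow heavy n

    edge-partition : ∀ d v → 1 ≤ d → d ≤ r → v < n → 𝟙 (bothLight d v) + (heavy v + heavy (shift d v)) ≡ 1
    edge-partition d v 1≤d d≤r v<n with light v in lv | light (shift d v) in lw
    ... | true | true = refl
    ... | true | false = refl
    ... | false | true = refl
    ... | false | false = ⊥-elim (independent v d v<n 1≤d d≤r lv lw)

    -- Each vertex is on two edges of a row, so a row has n − 2s light edges.
    length-row-+ : ∀ d → 1 ≤ d → d ≤ r → length (row d) + (heavyCount + heavyCount) ≡ n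
    length-row-+ d 1≤d d≤r = begin
      length (row d) + (heavyCount + heavyCount)
        ≡⟨ cong₂ (λ x y → x + (heavyCount + y)) (length-row d)
                 (sym (sumBelow-rotate n d heavy (<⇒≤ (≤-<-trans d≤r r<n)))) ⟩
      sumBelow (λ v → 𝟙 (bothLight d v)) n + (heavyCount + sumBelow (λ v → heavy (shift d v)) n)
        ≡⟨ cong (sumBelow (λ v → 𝟙 (bothLight d v)) n +_) (sumBelow-+ heavy (λ v → heavy (shift d v)) n) ⟨
      sumBelow (λ v → 𝟙 (bothLight d v)) n + sumBelow (λ v → heavy v + heavy (shift d v)) n
        ≡⟨ sumBelow-+ (λ v → 𝟙 (bothLight d v)) (λ v → heavy v + heavy (shift d v)) n ⟨
      sumBelow (λ v → 𝟙 (bothLight d v) + (heavy v + heavy (shift d v))) n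
        ≡⟨ sumBelow-cong n (λ v → edge-partition d v 1≤d d≤r) ⟩
      sumBelow (λ _ → 1) n
        ≡⟨ trans (sumBelow-const 1 n) (*-identityʳ n) ⟩
      n ∎
      where open ≡-Reasoning

    length-row-≡ : ∀ d → 1 ≤ d → d ≤ r → length (row d) ≡ n ∸ (heavyCount + heavyCount)
    length-row-≡ d 1≤d d≤r =
      trans (sym (m+n∸n≡m _ (heavyCount + heavyCount))) (cong (_∸ (heavyCount + heavyCount)) (length-row-+ d 1≤d d≤r))

    length-rows : ∀ D → D ≤ r → length (rows D) ≡ D * (n ∸ (heavyCount + heavyCount))
    length-rows zero _ = refl
    length-rows (suc D) D<r = trans (length-++ (row (suc D)))
      (cong₂ _+_ (length-row-≡ (suc D) (s≤s z≤n) D<r) (length-rows D (≤-trans (n≤1+n D) D<r)))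

    window : ∀ v → sumBelow (λ j → heavy ((v + j) % n)) (suc r) ≤ 1
    window v = sumBelow-sparse (λ j → not (light ((v + j) % n))) (suc r) two-heavy
      where
      two-heavy : ∀ j₁ j₂ → j₁ < j₂ → j₂ < suc r → not (light ((v + j₁) % n)) ≡ true → not (light ((v + j₂) % n)) ≡ true → ⊥
      two-heavy j₁ j₂ j₁<j₂ j₂≤r h₁ h₂ =
        independent ((v + j₁) % n) (j₂ ∸ j₁) (m%n<n (v + j₁) n) (m<n⇒0<n∸m j₁<j₂) (≤-trans (m∸n≤m j₂ j₁) (≤-pred j₂≤r))
          (not-true h₁) (subst (λ w → light w ≡ false) (sym same) (not-true h₂))
        where
        same : shift (j₂ ∸ j₁) ((v + j₁) % n) ≡ (v + j₂) % n
        same = ≋-trans (≋-+ʳ (j₂ ∸ j₁) (%-≋ (v + j₁)))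
                 (≡⇒≋ (trans (+-assoc v j₁ (j₂ ∸ j₁)) (cong (v +_) (m+[n∸m]≡n (<⇒≤ j₁<j₂)))))

    -- … so, averaging over all n windows, s·(r + 1) ≤ n.
    heavy-packing : heavyCount * suc r ≤ n
    heavy-packing = begin
      heavyCount * suc r                                          ≡⟨ *-comm heavyCount (suc r) ⟩
      suc r * heavyCount                                          ≡⟨ sumBelow-const heavyCount (suc r) ⟨
      sumBelow (λ _ → heavyCount) (suc r)                         ≡⟨ sumBelow-cong (suc r) rotated ⟨
      sumBelow (λ j → sumBelow (λ v → heavy ((v + j) % n)) n) (suc r)
                                                                  ≡⟨ sumBelow-swap (λ j v → heavy ((v + j) % n)) (suc r) n ⟩
      sumBelow (λ v → sumBelow (λ j → heavy ((v + j) % n)) (suc r)) n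
                                                                  ≤⟨ sumBelow-mono-≤ n (λ v _ → window v) ⟩
      sumBelow (λ _ → 1) n                                        ≡⟨ trans (sumBelow-const 1 n) (*-identityʳ n) ⟩
      n                                                           ∎
      where
      open ≤-Reasoning
      rotated : ∀ j → j < suc r → sumBelow (λ v → heavy ((v + j) % n)) n ≡ heavyCount
      rotated j j≤r = sumBelow-rotate n j heavy (<⇒≤ (≤-<-trans (≤-pred j≤r) r<n))

  module LowerBound (f : Fin n → SubsetN) (weak : WeakIASI G f) where
    open IASI (WeakIASI.iasi weak)

    size : ℕ → ℕ
    size v = proj₁ (finite (ι v))

    size-HasCard : ∀ v → HasCard (f (ι v)) (size v)
    size-HasCard v = proj₂ (finite (ι v))

    light : ℕ → Bool
    light v with size v ℕ.≟ 1
    ... | yes _ = true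
    ... | no _ = false

    light⇒singleton : ∀ v → light v ≡ true → ∃ λ c → SameSet (f (ι v)) (Sing c)
    light⇒singleton v lv with size v ℕ.≟ 1
    ... | yes size≡1 = HasCard-1⇒Sing (subst (HasCard (f (ι v))) size≡1 (size-HasCard v))

    heavy⇒large : ∀ v → light v ≡ false → 2 ≤ size v
    heavy⇒large v hv with size v ℕ.≟ 1
    ... | no size≢1 = ≤∧≢⇒< (HasCard⇒NonEmpty⇒≥1 (size-HasCard v) (nonEmpty (ι v))) (λ e → size≢1 (sym e))

    independent : HeavyIndependent light
    independent v d v<n 1≤d d≤r hv hw =
      ¬weak-both-large (size-HasCard v) (size-HasCard (shift d v)) (heavy⇒large v hv) (heavy⇒large _ hw)
        (WeakIASI.weak weak _ _ (adj-shift v d 1≤d d≤r) _ _ (size-HasCard v) (size-HasCard (shift d v)))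

    open Counting light independent

    heavyCount≤q : heavyCount ≤ n / suc r
    heavyCount≤q = subst (_≤ n / suc r) (m*n/n≡m heavyCount (suc r)) (/-monoˡ-≤ (suc r) heavy-packing)

    lower-bound : ∀ m → MonoCount G f m → r * (n ∸ (n / suc r + n / suc r)) ≤ m
    lower-bound m (es , es-unique , refl , es-mono) = begin
      r * (n ∸ (n / suc r + n / suc r))       ≤⟨ *-monoʳ-≤ r (∸-monoʳ-≤ n (+-mono-≤ heavyCount≤q heavyCount≤q)) ⟩
      r * (n ∸ (heavyCount + heavyCount))     ≡⟨ length-rows r ≤-refl ⟨
      length (rows r)                         ≤⟨ unique-⊆⇒length-≤ (≡-dec Fin._≟_ Fin._≟_) (rows-unique r ≤-refl) rows⊆es ⟩
      length es                               ∎
      where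
      open ≤-Reasoning
      rows⊆es : ∀ {e} → e ∈ rows r → e ∈ es
      rows⊆es {u , v} e∈ = proj₁ (es-mono u v) (rows-mono f (λ v _ → light⇒singleton v) e∈)

  module PowerLabelling (marked : ℕ → Bool)
    (spaced : ∀ a d → marked a ≡ true → 1 ≤ d → d ≤ r → marked (shift d a) ≡ false) where

    label : Fin n → SubsetN
    label u = if marked (toℕ u) then Pair (pow2 (toℕ u)) else Sing (pow2 (toℕ u))

    label-has : ∀ u → label u (pow2 (toℕ u))
    label-has u with marked (toℕ u)
    ... | true = inj₁ refl
    ... | false = refl

    label-least : ∀ u x → label u x → pow2 (toℕ u) ≤ x
    label-least u x x∈ with marked (toℕ u)
    label-least u x (inj₁ refl) | true = ≤-refl
    label-least u x (inj₂ refl) | true = n≤1+n _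
    label-least u x refl | false = ≤-refl

    label-unmarked : ∀ u → marked (toℕ u) ≡ false → SameSet (label u) (Sing (pow2 (toℕ u)))
    label-unmarked u mu x with marked (toℕ u)
    label-unmarked u refl x | false = (λ p → p) , (λ p → p)

    ⊕-least : ∀ u v x → (label u ⊕ label v) x → pow2 (toℕ u) + pow2 (toℕ v) ≤ x
    ⊕-least u v x (a , b , a∈ , b∈ , refl) = +-mono-≤ (label-least u a a∈) (label-least v b b∈)

    ⊕-has : ∀ u v → (label u ⊕ label v) (pow2 (toℕ u) + pow2 (toℕ v))
    ⊕-has u v = pow2 (toℕ u) , pow2 (toℕ v) , label-has u , label-has v , refl

    marked-nonadjacent : ∀ {u v} → Adj G u v → marked (toℕ u) ≡ true → marked (toℕ v) ≡ true → ⊥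
    marked-nonadjacent uv mu mv with adj⇒shift uv
    ... | d , 1≤d , d≤r , inj₁ u+d≡v with () ← trans (sym (spaced _ d mu 1≤d d≤r)) (trans (cong marked u+d≡v) mv)
    ... | d , 1≤d , d≤r , inj₂ v+d≡u with () ← trans (sym (spaced _ d mv 1≤d d≤r)) (trans (cong marked v+d≡u) mu)

    size : Fin n → ℕ
    size u = if marked (toℕ u) then 2 else 1

    label-HasCard : ∀ u → HasCard (label u) (size u)
    label-HasCard u with marked (toℕ u)
    ... | true = HasCard-Pair _
    ... | false = HasCard-Sing _

    -- On an edge at most one end is marked, so the sumset is a pair or a singleton as required.
    edge-HasCard : ∀ {u v} → Adj G u v → HasCard (label u ⊕ label v) (size u ⊔ size v)
    edge-HasCard {u} {v} uv with marked (toℕ u) in mu | marked (toℕ v) in mv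
    ... | true | true = ⊥-elim (marked-nonadjacent uv mu mv)
    ... | true | false = HasCard-resp (≐-sym (Pair⊕Sing _ _)) (HasCard-Pair _)
    ... | false | true = HasCard-resp (≐-sym (Sing⊕Pair _ _)) (HasCard-Pair _)
    ... | false | false = HasCard-resp (≐-sym (Sing⊕Sing _ _)) (HasCard-Sing _)

    unmarked-if-mono : ∀ {u v} → Adj G u v → HasCard (label u ⊕ label v) 1 →
                       not (marked (toℕ u)) ≡ true × not (marked (toℕ v)) ≡ true
    unmarked-if-mono {u} {v} uv card with HasCard-unique card (edge-HasCard uv)
    ... | 1≡ with marked (toℕ u) | marked (toℕ v)
    ... | false | false = refl , refl
    ... | true | true with () ← 1≡
    ... | true | false with () ← 1≡
    ... | false | true with () ← 1≡

    weakIASI : WeakIASI G label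
    weakIASI = record
      { iasi = record
        { nonEmpty = λ u → pow2 (toℕ u) , label-has u
        ; finite = λ u → size u , label-HasCard u
        ; injective = λ u v u≐v → toℕ-injective (pow2-injective _ _
            (≐-least (label-least u) (label-has u) (label-least v) (label-has v) u≐v))
        ; edgeInjective = λ u v x y uv xy uv≐xy →
            Sum.map (Product.map toℕ-injective toℕ-injective) (Product.map toℕ-injective toℕ-injective)
              (pow2-sidon (toℕ u) (toℕ v) (toℕ x) (toℕ y) (toℕ-≢ (proj₁ uv)) (toℕ-≢ (proj₁ xy))
                (≐-least (⊕-least u v) (⊕-has u v) (⊕-least x y) (⊕-has x y) uv≐xy))
        }
      ; weak = λ u v uv a b |u|≡a |v|≡b →
          subst (HasCard (label u ⊕ label v))
            (cong₂ _⊔_ (HasCard-unique (label-HasCard u) |u|≡a) (HasCard-unique (label-HasCard v) |v|≡b))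
            (edge-HasCard uv)
      }
      where toℕ-≢ : ∀ {u v : Fin n} → u ≢ v → toℕ u ≢ toℕ v
            toℕ-≢ u≢v e = u≢v (toℕ-injective e)

    light : ℕ → Bool
    light v = not (marked v)

    independent : HeavyIndependent light
    independent v d _ 1≤d d≤r hv hw with marked v in mv
    independent v d _ 1≤d d≤r refl hw | true with () ← trans (sym (cong not (spaced v d mv 1≤d d≤r))) hw

    open Counting light independent

    monoCount : MonoCount G label (r * (n ∸ (heavyCount + heavyCount)))
    monoCount = rows r , rows-unique r ≤-refl , length-rows r ≤-refl , λ u v → mono⇒∈ , ∈⇒mono
      where
      mono⇒∈ : ∀ {u v} → MonoEdge G label u v → (u , v) ∈ rows r
      mono⇒∈ (u<v , uv , card) = let (lu , lv) = unmarked-if-mono uv card in adj⇒∈rows uv u<v lu lv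
      ∈⇒mono : ∀ {u v} → (u , v) ∈ rows r → MonoEdge G label u v
      ∈⇒mono = rows-mono label (λ v v<n lv → pow2 (toℕ (ι v)) ,
        label-unmarked (ι v) (trans (cong marked (toℕ-ι-< v<n)) (not-true lv)))

  module Marking where
    R q Q : ℕ
    R = suc r
    q = n / R
    Q = q * R

    marked : ℕ → Bool
    marked v with v <? Q | v % R ℕ.≟ 0
    ... | yes _ | yes _ = true
    ... | _ | _ = false

    marked-intro : ∀ {v} → v < Q → v % R ≡ 0 → marked v ≡ true
    marked-intro {v} v<Q v%R≡0 with v <? Q | v % R ℕ.≟ 0
    ... | yes _ | yes _ = refl
    ... | no v≮Q | _ = ⊥-elim (v≮Q v<Q)
    ... | yes _ | no v%R≢0 = ⊥-elim (v%R≢0 v%R≡0)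

    marked-elim : ∀ {v} → marked v ≡ true → v < Q × v % R ≡ 0
    marked-elim {v} mv with v <? Q | v % R ℕ.≟ 0
    ... | yes v<Q | yes v%R≡0 = v<Q , v%R≡0

    unmarked-beyond : ∀ {v} → ¬ v < Q → marked v ≡ false
    unmarked-beyond {v} v≮Q with v <? Q | v % R ℕ.≟ 0
    ... | yes v<Q | yes _ = ⊥-elim (v≮Q v<Q)
    ... | yes _ | no _ = refl
    ... | no _ | _ = refl

    unmarked-off : ∀ {v} → v % R ≢ 0 → marked v ≡ false
    unmarked-off {v} v%R≢0 with v <? Q | v % R ℕ.≟ 0
    ... | yes _ | yes v%R≡0 = ⊥-elim (v%R≢0 v%R≡0)
    ... | yes _ | no _ = refl
    ... | no _ | _ = refl

    -- Marked vertices are r + 1 apart, even across the wrap-around, since Q ≤ n.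
    spaced : ∀ a d → marked a ≡ true → 1 ≤ d → d ≤ r → marked (shift d a) ≡ false
    spaced a d ma 1≤d d≤r = unmarked-off (λ e → <-irrefl (sym (d≡0 e)) 1≤d)
      where
      a<Q : a < Q
      a<Q = proj₁ (marked-elim ma)
      k : ℕ
      k = a / R
      a≡kR : a ≡ k * R
      a≡kR = trans (m≡m%n+[m/n]*n a R) (cong (_+ k * R) (proj₂ (marked-elim ma)))
      a+R≤Q : a + R ≤ Q
      a+R≤Q = subst (_≤ Q) (trans (+-comm R (k * R)) (cong (_+ R) (sym a≡kR))) (*-monoˡ-≤ R {suc k} {q} (m<n*o⇒m/o<n a<Q))
      shift≡ : shift d a ≡ a + d
      shift≡ = m<n⇒m%n≡m (≤-trans (+-monoʳ-< a (s≤s d≤r)) (≤-trans a+R≤Q (m/n*n≤m n R)))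
      d≡0 : shift d a % R ≡ 0 → d ≡ 0
      d≡0 e = begin
        d                  ≡⟨ m<n⇒m%n≡m (s≤s d≤r) ⟨
        d % R              ≡⟨ [m+kn]%n≡m%n d k R ⟨
        (d + k * R) % R    ≡⟨ cong (_% R) (trans (+-comm d (k * R)) (cong (_+ d) (sym a≡kR))) ⟩
        (a + d) % R        ≡⟨ cong (_% R) shift≡ ⟨
        shift d a % R      ≡⟨ e ⟩
        0                  ∎
        where open ≡-Reasoning

    block-count : ∀ t → t < q → sumBelow (λ j → 𝟙 (marked (t * R + j))) R ≡ 1
    block-count t t<q = cong₂ _+_ first (sumBelow-zero r rest)
      where
      first : 𝟙 (marked (t * R + 0)) ≡ 1
      first = cong 𝟙 (marked-intro (subst (_< Q) (sym (+-identityʳ _)) (*-monoˡ-< R t<q))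
                                    (trans (cong (_% R) (+-identityʳ (t * R))) (m*n%n≡0 t R)))
      rest : ∀ j → j < r → 𝟙 (marked (t * R + suc j)) ≡ 0
      rest j j<r = cong 𝟙 (unmarked-off (λ e → 1+j≢0 (trans (sym off) e)))
        where
        1+j≢0 : suc j ≢ 0
        1+j≢0 ()
        off : (t * R + suc j) % R ≡ suc j
        off = trans (cong (_% R) (+-comm (t * R) (suc j))) (trans ([m+kn]%n≡m%n (suc j) t R) (m<n⇒m%n≡m (s≤s j<r)))

    blocks-count : ∀ t → t ≤ q → sumBelow (λ v → 𝟙 (marked v)) (t * R) ≡ t
    blocks-count zero _ = refl
    blocks-count (suc t) t<q = begin
      sumBelow g (R + t * R)                                   ≡⟨ cong (sumBelow g) (+-comm R (t * R)) ⟩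
      sumBelow g (t * R + R)                                   ≡⟨ sumBelow-split g (t * R) R ⟩
      sumBelow g (t * R) + sumBelow (λ j → g (t * R + j)) R    ≡⟨ cong₂ _+_ (blocks-count t (<⇒≤ t<q)) (block-count t t<q) ⟩
      t + 1                                                    ≡⟨ +-comm t 1 ⟩
      suc t                                                    ∎
      where open ≡-Reasoning
            g : ℕ → ℕ
            g v = 𝟙 (marked v)

    marked-count : sumBelow (λ v → 𝟙 (marked v)) n ≡ q
    marked-count = begin
      sumBelow g n                                             ≡⟨ cong (sumBelow g) n≡Q+ ⟩
      sumBelow g (Q + n % R)                                   ≡⟨ sumBelow-split g Q (n % R) ⟩
      sumBelow g Q + sumBelow (λ j → g (Q + j)) (n % R)        ≡⟨ cong₂ _+_ (blocks-count q ≤-refl) (sumBelow-zero (n % R) beyond) ⟩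
      q + 0                                                    ≡⟨ +-identityʳ q ⟩
      q                                                        ∎
      where
      open ≡-Reasoning
      g : ℕ → ℕ
      g v = 𝟙 (marked v)
      n≡Q+ : n ≡ Q + n % R
      n≡Q+ = trans (m≡m%n+[m/n]*n n R) (+-comm (n % R) Q)
      beyond : ∀ j → j < n % R → g (Q + j) ≡ 0
      beyond j _ = cong 𝟙 (unmarked-beyond (λ Q+j<Q → <-irrefl refl (≤-<-trans (m≤m+n Q j) Q+j<Q)))

    open PowerLabelling marked spaced
    open Counting light independent using (heavyCount)

    heavyCount≡q : heavyCount ≡ q
    heavyCount≡q = trans (sumBelow-cong n (λ v _ → cong 𝟙 (not-involutive (marked v)))) marked-count

    upper-bound : Σ (Fin n → SubsetN) λ f → WeakIASI G f × MonoCount G f (r * (n ∸ (q + q)))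
    upper-bound = label , weakIASI , subst (λ s → MonoCount G label (r * (n ∸ (s + s)))) heavyCount≡q monoCount

sparing-number : ∀ n r {{_ : NonZero n}} → r + r < n →
                 IsSparingNumber (Power (Cycle n) r) (r * (n ∸ (n / suc r + n / suc r)))
sparing-number n r 2r<n = Marking.upper-bound , λ f m weak → LowerBound.lower-bound f weak m
  where open CyclePower n r 2r<n

closed-form : ∀ {n r i q} → 1 ≤ r → n ≡ i + q * suc r →
              r * (n ∸ (q + q)) * (r + 1) ≡ r * ((r ∸ 1) * n + 2 * i)
closed-form {n} {suc r′} {i} {q} _ refl = begin
  suc r′ * (i + q * suc (suc r′) ∸ (q + q)) * (suc r′ + 1)   ≡⟨ cong (λ m → suc r′ * m * (suc r′ + 1)) n∸2q ⟩
  suc r′ * (i + q * r′) * (suc r′ + 1)                        ≡⟨ expand i q r′ ⟩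
  suc r′ * (r′ * (i + q * suc (suc r′)) + 2 * i)              ∎
  where
  open ≡-Reasoning
  n∸2q : i + q * suc (suc r′) ∸ (q + q) ≡ i + q * r′
  n∸2q = trans (cong (_∸ (q + q)) (split i q r′)) (m+n∸n≡m (i + q * r′) (q + q))
    where split : ∀ i q r′ → i + q * suc (suc r′) ≡ (i + q * r′) + (q + q)
          split = solve-∀
  expand : ∀ i q r′ → suc r′ * (i + q * r′) * (suc r′ + 1) ≡ suc r′ * (r′ * (i + q * suc (suc r′)) + 2 * i)
  expand = solve-∀

<half⇒double< : ∀ {n r} → r < n / 2 → r + r < n
<half⇒double< {n} {r} r<n/2 = begin-strict
  r + r              <⟨ n<1+n (r + r) ⟩
  suc (r + r)        <⟨ n<1+n (suc (r + r)) ⟩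
  suc (suc (r + r))  ≡⟨ double r ⟩
  suc r * 2          ≤⟨ *-monoˡ-≤ 2 r<n/2 ⟩
  n / 2 * 2          ≤⟨ m/n*n≤m n 2 ⟩
  n                  ∎
  where
  open ≤-Reasoning
  double : ∀ r → suc (suc (r + r)) ≡ suc r * 2
  double = solve-∀

mainTheorem14 : (n r i : ℕ) → 1 ≤ r → r < n / 2 → i ≤ r → n % suc r ≡ i →
    Σ ℕ λ φ → IsSparingNumber (Power (Cycle n) r) φ ×
    φ * (r + 1) ≡ r * ((r ∸ 1) * n + 2 * i)
mainTheorem14 zero r i _ () _ _
mainTheorem14 n@(suc _) r i 1≤r r<n/2 _ n%R≡i =
  r * (n ∸ (q + q)) , sparing-number n r (<half⇒double< r<n/2) , closed-form {n} {r} {i} {q} 1≤r n≡i+qR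
  where
  q : ℕ
  q = n / suc r
  n≡i+qR : n ≡ i + q * suc r
  n≡i+qR = trans (m≡m%n+[m/n]*n n (suc r)) (cong (_+ q * suc r) n%R≡i)
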